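{- Let $A_k=\{0=a_0<a_1<\cdots<a_k\}$ be a restricted basis with range $n$. Let $i$ be an index with $0<i<k-1$, and let $j=k-1-i$. Then: (1) The prefix $A_i=\{a_0,\ldots,a_i\}$ is an admissible basis with $n_2(A_i)\ge a_k-n_2(j-1)-2$. (2) The mirrored suffix $B_j=a_k-\{a_{i+1},\ldots,a_k\}=\{a_k-a_{i+1},\ldots,a_k-a_k\}$ is an admissible basis with $n_2(B_j)\ge a_k-n_2(i-1)-2$. Here $n_2(m)$ denotes the maximum range among all bases of length $m$.
   Context: For a set of integers $A$, $2A=A+A=\{a+a': a,a'\in A\}$, and $[c,d]=\{c,\ldots,d\}$. A basis of length $m$ is a set of integers $A_m=\{0=a_0<a_1<\cdots<a_m\}$ (the element $0$ is not counted in the length). Its range $n_2(A_m)$ is the largest $n$ with $2A_m\supseteq[0,n]$. A basis is admissible if $n_2(A_m)\ge a_m$, and restricted if $n_2(A_m)\ge 2a_m$. For an integer $b$ and set $A$, $b-A=\{b-a:a\in A\}$. For $m\ge 0$, $n_2(m)$ is the maximum of $n_2(A_m)$ over all bases $A_m$ of length $m$ (so $n_2(0)=0$, the basis being $\{0\}$). -}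

module Defs where

open import Data.Nat using (ℕ; zero; suc; _+_; _*_; _∸_; _≤_; _<_)
open import Data.Product using (Σ; ∃; _×_)
open import Relation.Binary.PropositionalEquality using (_≡_)
open import Relation.Nullary using (¬_)

-- A basis of length m is represented by a function a : ℕ → ℕ together with
-- its length m; its elements are a 0 , a 1 , … , a m (values beyond m are
-- irrelevant).
IsBasis : (ℕ → ℕ) → ℕ → Set
IsBasis a m = (a 0 ≡ 0) × (∀ t → t < m → a t < a (suc t))

InSumset : (ℕ → ℕ) → ℕ → ℕ → Set
InSumset a m x = Σ ℕ λ p → Σ ℕ λ q → (p ≤ m) × (q ≤ m) × (a p + a q ≡ x)

IsRange : (ℕ → ℕ) → ℕ → ℕ → Set
IsRange a m n = (∀ x → x ≤ n → InSumset a m x) × ¬ InSumset a m (suc n)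

IsN2 : ℕ → ℕ → Set
IsN2 m N =
  (Σ (ℕ → ℕ) λ a → IsBasis a m × IsRange a m N)
  × (∀ a n → IsBasis a m → IsRange a m n → n ≤ N)

IsAdmissible : (ℕ → ℕ) → ℕ → Set
IsAdmissible a m = IsBasis a m × (∀ n → IsRange a m n → a m ≤ n)

IsRestricted : (ℕ → ℕ) → ℕ → Set
IsRestricted a m = IsBasis a m × (∀ n → IsRange a m n → 2 * a m ≤ n)

-- the mirrored suffix a k - {a (i+1), …, a k}, indexed as
-- b t = a k - a (k - t), t = 0 … j, where j = k - 1 - i (so k - j = i + 1)
mirror : (ℕ → ℕ) → ℕ → (ℕ → ℕ)
mirror a k t = a k ∸ a (k ∸ t)

module Submission where

-- A restricted basis A = {a 0 < … < a k} satisfies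
-- 2A ⊇ [0, 2 a k]; call such a basis complete.  Two truncations of a complete
-- basis still represent everything below their "next element":
--   * the prefix A_s represents [0, a (s+1)), since a sum below a (s+1) can
--     only use summands a 0 … a s;
--   * the mirrored suffix B_L = a k - {a (k-L), …, a k} represents
--     [0, b (L+1)) where b (L+1) = a k - a (k-L-1): for such y, 2 a k - y is
--     a sum a p + a q of two elements both beyond a (k-L-1), and mirroring
--     that representation gives y.
-- A basis whose sumset contains [0, c) has range at least c - 1, and so
-- does the optimal basis of the same length (every basis has a range,
-- because its sumset is decidable and bounded).  Applied to the next element
-- this makes each truncation admissible; and since a k splits as
-- a w + (a k - a w), the two truncations meeting at the index w bound a k by
-- the sum of their ranges plus 2, which is the theorem.

open import Defs
open import Data.Nat using (ℕ; zero; suc; _+_; _*_; _∸_; _≤_; _<_; z≤n; s≤s; s≤s⁻¹; pred; _≟_)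
open import Data.Nat.Properties
open import Data.Product using (∃; _×_; _,_; proj₁; proj₂)
open import Data.Sum using (_⊎_; inj₁; inj₂)
open import Data.Empty using (⊥-elim)
open import Relation.Nullary using (¬_; Dec; yes; no)
open import Relation.Nullary.Decidable using (map′)
open import Relation.Binary.PropositionalEquality
  using (_≡_; refl; sym; trans; cong; cong₂; subst; module ≡-Reasoning)

Covers : (ℕ → ℕ) → ℕ → ℕ → Set
Covers a m c = ∀ x → x < c → InSumset a m x

Complete : (ℕ → ℕ) → ℕ → Set
Complete a m = ∀ x → x ≤ a m + a m → InSumset a m x

module Basis {a : ℕ → ℕ} {m : ℕ} (basis : IsBasis a m) where

  mono< : ∀ {p q} → p < q → q ≤ m → a p < a q
  mono< {p} {suc q} p<1+q 1+q≤m with m≤n⇒m<n∨m≡n (s≤s⁻¹ p<1+q)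
  ... | inj₁ p<q  = <-trans (mono< p<q (<⇒≤ 1+q≤m)) (proj₂ basis q 1+q≤m)
  ... | inj₂ refl = proj₂ basis q 1+q≤m

  mono≤ : ∀ {p q} → p ≤ q → q ≤ m → a p ≤ a q
  mono≤ p≤q q≤m with m≤n⇒m<n∨m≡n p≤q
  ... | inj₁ p<q  = <⇒≤ (mono< p<q q≤m)
  ... | inj₂ refl = ≤-refl

  below-top : ∀ {p} → p ≤ m → a p ≤ a m
  below-top p≤m = mono≤ p≤m ≤-refl

  index< : ∀ {p s} → p ≤ m → a p < a s → p < s
  index< {p} {s} p≤m ap<as = ≰⇒> λ s≤p → <⇒≱ ap<as (mono≤ s≤p p≤m)

  sum-bounded : ∀ {x} → InSumset a m x → x ≤ a m + a m
  sum-bounded (p , q , p≤m , q≤m , refl) = +-mono-≤ (below-top p≤m) (below-top q≤m)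

  zero-in-sumset : InSumset a m 0
  zero-in-sumset = 0 , 0 , z≤n , z≤n , cong₂ _+_ (proj₁ basis) (proj₁ basis)

prefix-basis : ∀ {a k s} → IsBasis a k → s ≤ k → IsBasis a s
prefix-basis (a0 , step) s≤k = a0 , λ t t<s → step t (≤-trans t<s s≤k)

mirror-basis : ∀ {a k L} → IsBasis a k → L ≤ k → IsBasis (mirror a k) L
mirror-basis {a} {k} {L} basis L≤k = n∸n≡0 (a k) , step
  where
  open Basis basis
  -- b t < b (t+1) because a (k-t-1) < a (k-t)
  step : ∀ t → t < L → mirror a k t < mirror a k (suc t)
  step t t<L = ∸-monoʳ-< (mono< (subst (k ∸ suc t <_) k-t≡ ≤-refl) (m∸n≤m k t))
                         (below-top (m∸n≤m k t))
    where
    k-t≡ : suc (k ∸ suc t) ≡ k ∸ t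
    k-t≡ = sym (+-∸-assoc 1 (≤-trans t<L L≤k))

mirror-flip : ∀ a {k p} → p ≤ k → mirror a k (k ∸ p) ≡ a k ∸ a p
mirror-flip a {k} p≤k = cong (λ t → a k ∸ a t) (m∸[m∸n]≡n p≤k)

split-top : ∀ {a k w L} → IsBasis a k → w + L ≡ k → a w + mirror a k L ≡ a k
split-top {a} {k} {w} {L} basis w+L≡k = begin
  a w + (a k ∸ a (k ∸ L))  ≡⟨ cong (λ t → a w + (a k ∸ a t)) k-L≡w ⟩
  a w + (a k ∸ a w)        ≡⟨ m+[n∸m]≡n (below-top w≤k) ⟩
  a k                      ∎
  where
  open Basis basis
  open ≡-Reasoning
  w≤k : w ≤ k
  w≤k = subst (w ≤_) w+L≡k (m≤m+n w L)
  k-L≡w : k ∸ L ≡ w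
  k-L≡w = trans (cong (_∸ L) (sym w+L≡k)) (m+n∸n≡m w L)

-- Membership in 2A is decidable: only the finitely many pairs p, q ≤ m matter.
insumset? : ∀ a m x → Dec (InSumset a m x)
insumset? a m x =
  map′ to from (anyUpTo? (λ p → anyUpTo? (λ q → a p + a q ≟ x) (suc m)) (suc m))
  where
  Pairs : Set
  Pairs = ∃ λ p → p < suc m × ∃ λ q → q < suc m × (a p + a q ≡ x)
  to : Pairs → InSumset a m x
  to (p , p<1+m , q , q<1+m , e) = p , q , s≤s⁻¹ p<1+m , s≤s⁻¹ q<1+m , e
  from : InSumset a m x → Pairs
  from (p , q , p≤m , q≤m , e) = p , s≤s p≤m , q , s≤s q≤m , e

covered-or-gap : {P : ℕ → Set} → (∀ x → Dec (P x)) → P 0 → ∀ B →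
  (∀ x → x ≤ B → P x) ⊎ ∃ λ n → (∀ x → x ≤ n → P x) × ¬ P (suc n)
covered-or-gap P? P0 zero = inj₁ λ { zero _ → P0 }
covered-or-gap {P} P? P0 (suc B) with covered-or-gap P? P0 B
... | inj₂ gap = inj₂ gap
... | inj₁ upto-B with P? (suc B)
...   | no ¬P1+B = inj₂ (B , upto-B , ¬P1+B)
...   | yes P1+B = inj₁ upto-1+B
  where
  upto-1+B : ∀ x → x ≤ suc B → P x
  upto-1+B x x≤1+B with m≤n⇒m<n∨m≡n x≤1+B
  ... | inj₁ x<1+B = upto-B x (s≤s⁻¹ x<1+B)
  ... | inj₂ refl  = P1+B

-- Every basis has a range: its sumset contains 0 and misses 2 a m + 1.
range-exists : ∀ {a m} → IsBasis a m → ∃ (IsRange a m)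
range-exists {a} {m} basis
  with covered-or-gap (insumset? a m) (Basis.zero-in-sumset basis) (suc (a m + a m))
... | inj₁ everything =
  ⊥-elim (<-irrefl refl (Basis.sum-bounded basis (everything _ ≤-refl)))
... | inj₂ (n , upto-n , gap) = n , upto-n , gap

range-above : ∀ {a m r c} → IsRange a m r → Covers a m c → c ≤ suc r
range-above (_ , gap) covers = ≮⇒≥ λ 1+r<c → gap (covers _ 1+r<c)

n2-above : ∀ {a m N c} → IsBasis a m → Covers a m c → IsN2 m N → c ≤ suc N
n2-above {a} basis covers (_ , maximal) with range-exists basis
... | r , range = ≤-trans (range-above {a = a} range covers) (s≤s (maximal a r basis range))

next-admissible : ∀ {a m} → IsBasis a (suc m) → Covers a m (a (suc m)) → IsAdmissible a m
next-admissible {a} basis@(_ , step) covers =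
  prefix-basis basis (n≤1+n _) ,
  λ r range → s≤s⁻¹ (≤-trans (step _ ≤-refl) (range-above {a = a} range covers))

restricted-complete : ∀ {a k n} → IsRestricted a k → IsRange a k n → Complete a k
restricted-complete {a} {k} {n} (_ , wide) range@(upto-n , _) x x≤2ak =
  upto-n x (≤-trans x≤2ak (subst (_≤ n) twice (wide n range)))
  where
  twice : 2 * a k ≡ a k + a k
  twice = cong (a k +_) (+-identityʳ (a k))

prefix-sum : ∀ {a k s x} → IsBasis a k → s < k → InSumset a k x → x < a (suc s) →
             InSumset a s x
prefix-sum {a} basis s<k (p , q , p≤k , q≤k , refl) sum<next =
  p , q , s≤s⁻¹ (index< p≤k (≤-<-trans (m≤m+n (a p) (a q)) sum<next)) ,
          s≤s⁻¹ (index< q≤k (≤-<-trans (m≤n+m (a q) (a p)) sum<next)) , refl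
  where open Basis basis

prefix-covers : ∀ {a k s} → IsBasis a k → Complete a k → s < k → Covers a s (a (suc s))
prefix-covers {a} {k} basis complete s<k x x<next =
  prefix-sum basis s<k (complete x x≤2ak) x<next
  where
  open Basis basis
  x≤2ak : x ≤ a k + a k
  x≤2ak = ≤-trans (<⇒≤ x<next) (≤-trans (below-top s<k) (m≤m+n (a k) (a k)))

∸-sum : ∀ {K P Q} → P ≤ K → Q ≤ K → (K ∸ P) + (K ∸ Q) ≡ (K + K) ∸ (P + Q)
∸-sum {K} {P} {Q} P≤K Q≤K = begin
  (K ∸ P) + (K ∸ Q)   ≡⟨ sym (+-∸-assoc (K ∸ P) Q≤K) ⟩
  ((K ∸ P) + K) ∸ Q   ≡⟨ cong (_∸ Q) (sym (+-∸-comm K P≤K)) ⟩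
  ((K + K) ∸ P) ∸ Q   ≡⟨ ∸-+-assoc (K + K) P Q ⟩
  (K + K) ∸ (P + Q)   ∎
  where open ≡-Reasoning

-- The mirrored suffix B_L of a complete basis represents everything below its
-- next element b (L+1) = a k - a w, where w = k - (L+1): write 2 a k - y as
-- a p + a q; both summands lie beyond a w, so y = (a k - a p) + (a k - a q)
-- is a sum of two elements of B_L.
mirror-covers : ∀ {a k L} → IsBasis a k → Complete a k → L < k →
                Covers (mirror a k) L (mirror a k (suc L))
mirror-covers {a} {k} {L} basis complete L<k y y<next
  with complete ((a k + a k) ∸ y) (m∸n≤m (a k + a k) y)
... | p , q , p≤k , q≤k , sum≡ =
  k ∸ p , k ∸ q , mirrored-index (beyond q≤k sum≡) , mirrored-index (beyond p≤k sum≡′) ,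
  mirrored-sum
  where
  open Basis basis
  K : ℕ
  K = a k
  w : ℕ
  w = k ∸ suc L
  w≤k : w ≤ k
  w≤k = m∸n≤m k (suc L)
  y≤2K : y ≤ K + K
  y≤2K = ≤-trans (<⇒≤ y<next) (≤-trans (m∸n≤m K (a w)) (m≤m+n K K))
  sum≡′ : a q + a p ≡ (K + K) ∸ y
  sum≡′ = trans (+-comm (a q) (a p)) sum≡
  -- a summand a s with s ≤ w would force y ≥ (K + K) - (K + a w) = K - a w
  beyond : ∀ {s t} → t ≤ k → a s + a t ≡ (K + K) ∸ y → w < s
  beyond {s} {t} t≤k sum≡ = ≰⇒> λ s≤w → <⇒≱ y<next (y-large s≤w)
    where
    y-large : s ≤ w → K ∸ a w ≤ y
    y-large s≤w = begin
      K ∸ a w                 ≡⟨ sym ([m+n]∸[m+o]≡n∸o K K (a w)) ⟩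
      (K + K) ∸ (K + a w)     ≤⟨ ∸-monoʳ-≤ (K + K) small-sum ⟩
      (K + K) ∸ (a s + a t)   ≡⟨ cong ((K + K) ∸_) sum≡ ⟩
      (K + K) ∸ ((K + K) ∸ y) ≡⟨ m∸[m∸n]≡n y≤2K ⟩
      y                       ∎
      where
      open ≤-Reasoning
      small-sum : a s + a t ≤ K + a w
      small-sum = ≤-trans (+-mono-≤ (mono≤ s≤w w≤k) (below-top t≤k)) (≤-reflexive (+-comm (a w) K))
  mirrored-index : ∀ {s} → w < s → k ∸ s ≤ L
  mirrored-index w<s = ≤-trans (∸-monoʳ-≤ k w<s) (≤-reflexive k-[k-L]≡L)
    where
    k-[k-L]≡L : k ∸ suc w ≡ L
    k-[k-L]≡L = trans (sym (pred[m∸n]≡m∸[1+n] k w)) (cong pred (m∸[m∸n]≡n L<k))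
  mirrored-sum : mirror a k (k ∸ p) + mirror a k (k ∸ q) ≡ y
  mirrored-sum = begin
    mirror a k (k ∸ p) + mirror a k (k ∸ q) ≡⟨ cong₂ _+_ (mirror-flip a p≤k) (mirror-flip a q≤k) ⟩
    (K ∸ a p) + (K ∸ a q)                   ≡⟨ ∸-sum (below-top p≤k) (below-top q≤k) ⟩
    (K + K) ∸ (a p + a q)                   ≡⟨ cong ((K + K) ∸_) sum≡ ⟩
    (K + K) ∸ ((K + K) ∸ y)                 ≡⟨ m∸[m∸n]≡n y≤2K ⟩
    y                                       ∎
    where open ≡-Reasoning

add-bounds : ∀ {x y z u v} → x + y ≡ z → x ≤ suc u → y ≤ suc v → z ≤ u + v + 2
add-bounds {x} {y} {z} {u} {v} x+y≡z x≤1+u y≤1+v = begin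
  z             ≡⟨ sym x+y≡z ⟩
  x + y         ≤⟨ +-mono-≤ x≤1+u y≤1+v ⟩
  suc u + suc v ≡⟨ cong suc (+-suc u v) ⟩
  2 + (u + v)   ≡⟨ +-comm 2 (u + v) ⟩
  u + v + 2     ∎
  where open ≤-Reasoning

-- A complete basis of length k = i + j + 2 split into the prefix A_i and the
-- mirrored suffix B_j, which meet at the element a (i+1) = a k - b (j+1).
module Split {a k i j} (basis : IsBasis a k) (complete : Complete a k)
             (k≡ : suc (suc i + j) ≡ k) where

  private
    i<k : i < k
    i<k = subst (i <_) k≡ (s≤s (m≤n⇒m≤1+n (m≤m+n i j)))
    j<k : j < k
    j<k = subst (j <_) k≡ (s≤s (m≤n⇒m≤1+n (m≤n+m j i)))
    prefix : Covers a i (a (suc i))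
    prefix = prefix-covers basis complete i<k
    suffix : Covers (mirror a k) j (mirror a k (suc j))
    suffix = mirror-covers basis complete j<k
    meet : a (suc i) + mirror a k (suc j) ≡ a k
    meet = split-top basis (trans (+-suc (suc i) j) k≡)

  prefix-part : IsAdmissible a i ×
                (∀ r N → IsRange a i r → IsN2 j N → a k ≤ r + N + 2)
  prefix-part =
    next-admissible (prefix-basis basis i<k) prefix ,
    λ r N range n2 → add-bounds meet (range-above {a = a} range prefix)
                                     (n2-above (mirror-basis basis (<⇒≤ j<k)) suffix n2)

  suffix-part : IsAdmissible (mirror a k) j ×
                (∀ r N → IsRange (mirror a k) j r → IsN2 i N → a k ≤ r + N + 2)
  suffix-part =
    next-admissible (mirror-basis basis j<k) suffix ,
    λ r N range n2 → add-bounds (trans (+-comm (mirror a k (suc j)) (a (suc i))) meet)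
                                (range-above {a = mirror a k} range suffix)
                                (n2-above (prefix-basis basis (<⇒≤ i<k)) prefix n2)

-- Theorem 6.  With k = k' + 1, i = i' + 1 and j = k - 1 - i ≥ 1, part (1) is
-- the prefix part of the split (i, j - 1) and part (2) the suffix part of
-- the split (i - 1, j).
theorem6 : (k : ℕ) (a : ℕ → ℕ) (n : ℕ) (i : ℕ) →
    IsRestricted a k → IsRange a k n →
    0 < i → suc i < k →
    (IsAdmissible a i
    × (∀ r N → IsRange a i r → IsN2 ((k ∸ 1 ∸ i) ∸ 1) N → a k ≤ r + N + 2))
    × (IsAdmissible (mirror a k) (k ∸ 1 ∸ i)
    × (∀ r N → IsRange (mirror a k) (k ∸ 1 ∸ i) r → IsN2 (i ∸ 1) N →
    a k ≤ r + N + 2))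
theorem6 (suc k') a n (suc i') restricted@(basis , _) range _ (s≤s i+1<k') =
  Split.prefix-part basis complete split₁ , Split.suffix-part basis complete split₂
  where
  open ≡-Reasoning
  complete : Complete a (suc k')
  complete = restricted-complete restricted range
  j : ℕ
  j = k' ∸ suc i'
  i+j≡k' : suc i' + j ≡ k'
  i+j≡k' = m+[n∸m]≡n (<⇒≤ i+1<k')
  split₁ : suc (suc (suc i') + (j ∸ 1)) ≡ suc k'
  split₁ = cong suc (begin
    suc (suc i') + (j ∸ 1) ≡⟨ sym (+-suc (suc i') (j ∸ 1)) ⟩
    suc i' + suc (j ∸ 1)   ≡⟨ cong (suc i' +_) (sym (+-∸-assoc 1 (m<n⇒0<n∸m i+1<k'))) ⟩
    suc i' + j             ≡⟨ i+j≡k' ⟩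
    k'                     ∎)
  split₂ : suc (suc i' + j) ≡ suc k'
  split₂ = cong suc i+j≡k'
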